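{- Let $n\ge1$, let $S=\{i_1,i_2,\dots,i_k\}$ be a set of integers and let $T=\{n+1-i_k,\dots,n+1-i_1\}$. Then $\#P_B(S,n)=\#P_B(T,n)$.
   Context: $B_n$ is the set of signed permutations $\pi=\pi_1\cdots\pi_n$: words with each $\pi_i\in\{ -n,\dots,-1,1,\dots,n\}$ and $\{|\pi_1|,\dots,|\pi_n|\}=\{1,\dots,n\}$. An index $i\in\{2,\dots,n-1\}$ is a peak of $\pi$ if $\pi_{i-1}<\pi_i>\pi_{i+1}$, and $P_B(S,n)$ is the set of $\pi\in B_n$ whose set of peaks equals $S$. -}

module Defs where

open import Data.Nat using (ℕ; zero; suc; _≤_)
open import Data.Integer using (ℤ; +_; -[1+_]; ∣_∣; _<_; _<?_; _-_)
import Data.Integer.Properties as ℤP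
open import Data.List using (List; []; _∷_; map; upTo; _++_; length; filter; cartesianProductWith)
open import Data.List.Relation.Unary.All using (All; all?)
open import Data.List.Relation.Unary.Unique.Propositional using (Unique)
import Data.Nat.Properties as ℕP
open import Data.List.Relation.Unary.Unique.DecPropositional ℕP._≟_ using (unique?)
open import Data.List.Membership.Propositional using (_∈_)
open import Data.List.Membership.DecPropositional ℤP._≟_ using (_∈?_)
open import Data.Product using (_×_)
open import Relation.Nullary using (Dec; yes; no)
open import Relation.Nullary.Decidable using (_×-dec_; _⊎-dec_)
open import Data.Sum using (_⊎_)

-- A word over ℤ is a list; positions are 1-based.
-- Signed letters of B_n: {-n,…,-1,1,…,n}.
letters : ℕ → List ℤ
letters n = map (λ k → -[1+ k ]) (upTo n) ++ map (λ k → + suc k) (upTo n)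

words : {A : Set} → ℕ → List A → List (List A)
words zero    xs = [] ∷ []
words (suc n) xs = cartesianProductWith _∷_ xs (words n xs)

-- B_n: words of length n over {-n..-1,1..n} whose absolute values are pairwise
-- distinct (equivalently {|π_1|,…,|π_n|} = {1,…,n}).
-- Enumeration of B_n (as a list of words, without repetition).
Bn : ℕ → List (List ℤ)
Bn n = filter (λ π → unique? (map ∣_∣ π)) (words n (letters n))

-- Peak positions (1-based): index i with 2 ≤ i ≤ n-1 and π_{i-1} < π_i > π_{i+1}.
-- peaksFrom k w: w starts at position k of the full word.
peakHere : ℕ → ℤ → ℤ → ℤ → List ℕ → List ℕ
peakHere i a b c rest with a <? b | c <? b
... | yes _ | yes _ = i ∷ rest
... | _     | _     = rest

peaksFrom : ℕ → List ℤ → List ℕ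
peaksFrom k (a ∷ b ∷ c ∷ r) = peakHere (suc k) a b c (peaksFrom (suc k) (b ∷ c ∷ r))
peaksFrom k _ = []

peakSet : List ℤ → List ℤ
peakSet π = map +_ (peaksFrom 1 π)

_≈ₛ_ : List ℤ → List ℤ → Set
A ≈ₛ B = All (_∈ B) A × All (_∈ A) B

_≈ₛ?_ : (A B : List ℤ) → Dec (A ≈ₛ B)
A ≈ₛ? B = all? (_∈? B) A ×-dec all? (_∈? A) B

#PB : List ℤ → ℕ → ℕ
#PB S n = length (filter (λ π → peakSet π ≈ₛ? S) (Bn n))

reflectSet : ℕ → List ℤ → List ℤ
reflectSet n S = map (λ i → + suc n - i) S

module Submission where

-- Reversing a word π = π₁⋯πₙ turns a peak π_{i-1} < π_i > π_{i+1} at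
-- position i into a peak at position n+1-i, and every peak of the reverse
-- arises this way.  Since reversal is an involution of B_n, it therefore
-- restricts to a bijection between P_B(S,n) and P_B(T,n), T = {n+1-i : i ∈ S}.

open import Defs
open import Data.Nat as ℕ using (ℕ; zero; suc; _≤_)
import Data.Nat.Properties as ℕP
open import Data.Integer as ℤ using (ℤ; +_; -[1+_]; ∣_∣; _-_)
import Data.Integer.Properties as ℤP
open import Data.Integer.Tactic.RingSolver using (solve-∀)
open import Data.List
  using (List; []; _∷_; _++_; length; map; filter; reverse; upTo; cartesianProductWith)
open import Data.List.Properties
  using (length-map; length-++; length-reverse; reverse-++; reverse-map;
         reverse-involutive; ++-assoc)
open import Data.List.Membership.Propositional using (_∈_)
open import Data.List.Membership.Propositional.Properties
  using (∈-map⁺; ∈-map⁻; ∈-filter⁺; ∈-filter⁻;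
         ∈-cartesianProductWith⁺; ∈-cartesianProductWith⁻)
open import Data.List.Membership.Propositional.Properties.WithK using (unique∧set⇒bag)
open import Data.List.Relation.Unary.Any using (here; there)
open import Data.List.Relation.Unary.All as All using (All; []; _∷_)
open import Data.List.Relation.Unary.Unique.Propositional using (Unique)
import Data.List.Relation.Unary.Unique.Propositional.Properties as Unique
import Data.List.Relation.Unary.AllPairs as AllPairs
open import Data.List.Relation.Unary.Unique.DecPropositional ℕP._≟_ using (unique?)
open import Data.List.Relation.Binary.BagAndSetEquality using (∼bag⇒↭)
open import Data.List.Relation.Binary.Permutation.Propositional using (↭-sym; ↭⇒↭ₛ)
open import Data.List.Relation.Binary.Permutation.Propositional.Properties
  using (↭-length; ↭-reverse; All-resp-↭)
import Data.List.Relation.Binary.Permutation.Setoid.Properties as PermutationSetoid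
open import Data.Product using (∃; _×_; _,_; proj₁)
open import Data.Sum using (_⊎_; inj₁; inj₂)
open import Data.Empty using (⊥-elim)
open import Function.Bundles using (_⇔_; mk⇔; Equivalence)
open import Relation.Nullary using (yes; no; ¬_)
open import Relation.Unary using (Decidable)
open import Relation.Binary.PropositionalEquality
  using (_≡_; refl; sym; trans; cong; subst; setoid; module ≡-Reasoning)

Involution : {A : Set} → (A → A) → Set
Involution f = ∀ x → f (f x) ≡ x

unique-sameMembers-length : {A : Set} {xs ys : List A} → Unique xs → Unique ys →
  (∀ {x} → x ∈ xs ⇔ x ∈ ys) → length xs ≡ length ys
unique-sameMembers-length uxs uys same = ↭-length (∼bag⇒↭ (unique∧set⇒bag uxs uys same))

-- If an involution f maps xs into itself and P x holds iff Q (f x), then f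
-- is a bijection between the P-part and the Q-part of xs, so they have
-- equally many elements.
count-invariant : {A : Set} {P Q : A → Set} (P? : Decidable P) (Q? : Decidable Q)
  (f : A → A) → Involution f → {xs : List A} → Unique xs →
  (∀ {x} → x ∈ xs → f x ∈ xs) → (∀ {x} → x ∈ xs → P x ⇔ Q (f x)) →
  length (filter P? xs) ≡ length (filter Q? xs)
count-invariant {Q = Q} P? Q? f f-inv {xs} uxs closed P⇔Qf = begin
  length (filter P? xs)         ≡⟨ sym (length-map f (filter P? xs)) ⟩
  length (map f (filter P? xs)) ≡⟨ unique-sameMembers-length uImage uQ (mk⇔ image⊆Q Q⊆image) ⟩
  length (filter Q? xs)         ∎
  where
  open ≡-Reasoning
  f-injective : ∀ {x y} → f x ≡ f y → x ≡ y
  f-injective {x} {y} fx≡fy = trans (sym (f-inv x)) (trans (cong f fx≡fy) (f-inv y))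
  uImage : Unique (map f (filter P? xs))
  uImage = Unique.map⁺ f-injective (Unique.filter⁺ P? uxs)
  uQ : Unique (filter Q? xs)
  uQ = Unique.filter⁺ Q? uxs
  image⊆Q : ∀ {y} → y ∈ map f (filter P? xs) → y ∈ filter Q? xs
  image⊆Q y∈ with ∈-map⁻ f y∈
  ... | x , x∈ , refl with ∈-filter⁻ P? x∈
  ... | x∈xs , Px = ∈-filter⁺ Q? (closed x∈xs) (Equivalence.to (P⇔Qf x∈xs) Px)
  Q⊆image : ∀ {y} → y ∈ filter Q? xs → y ∈ map f (filter P? xs)
  Q⊆image {y} y∈ with ∈-filter⁻ Q? y∈
  ... | y∈xs , Qy = subst (_∈ map f (filter P? xs)) (f-inv y)
    (∈-map⁺ f (∈-filter⁺ P? (closed y∈xs)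
      (Equivalence.from (P⇔Qf (closed y∈xs)) (subst Q (sym (f-inv y)) Qy))))

Swaps : (ℤ → ℤ) → List ℤ → List ℤ → Set
Swaps g A B = (∀ {y} → y ∈ A → g y ∈ B) × (∀ {y} → y ∈ B → g y ∈ A)

swaps-sym : ∀ {g A B} → Swaps g A B → Swaps g B A
swaps-sym (A→B , B→A) = B→A , A→B

swaps-map : ∀ {g} → Involution g → (A : List ℤ) → Swaps g (map g A) A
swaps-map {g} g-inv A = image→A , ∈-map⁺ g
  where
  image→A : ∀ {y} → y ∈ map g A → g y ∈ A
  image→A y∈ with ∈-map⁻ g y∈
  ... | x , x∈A , refl = subst (_∈ A) (sym (g-inv x)) x∈A

≈ₛ-transport : ∀ {g A A' B B'} → Involution g → Swaps g A A' → Swaps g B B' →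
  A ≈ₛ B → A' ≈ₛ B'
≈ₛ-transport {_} {A} {A'} {B} {B'} g-inv (A→A' , A'→A) (B→B' , B'→B) (A⊆B , B⊆A) =
  All.tabulate A'⊆B' , All.tabulate B'⊆A'
  where
  A'⊆B' : ∀ {y} → y ∈ A' → y ∈ B'
  A'⊆B' {y} y∈ = subst (_∈ B') (g-inv y) (B→B' (All.lookup A⊆B (A'→A y∈)))
  B'⊆A' : ∀ {y} → y ∈ B' → y ∈ A'
  B'⊆A' {y} y∈ = subst (_∈ A') (g-inv y) (A→A' (All.lookup B⊆A (B'→B y∈)))

≈ₛ-transport⇔ : ∀ {g A A' B B'} → Involution g → Swaps g A A' → Swaps g B B' →
  A ≈ₛ B ⇔ A' ≈ₛ B'
≈ₛ-transport⇔ g-inv AA' BB' =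
  mk⇔ (≈ₛ-transport g-inv AA' BB') (≈ₛ-transport g-inv (swaps-sym AA') (swaps-sym BB'))

reflectIndex : ℕ → ℤ → ℤ
reflectIndex n i = + suc n - i

reflectIndex-involution : ∀ n → Involution (reflectIndex n)
reflectIndex-involution n = double-subtraction (+ suc n)
  where
  double-subtraction : ∀ a x → a - (a - x) ≡ x
  double-subtraction = solve-∀

reflectIndex-position : ∀ n i j → suc n ≡ i ℕ.+ j → reflectIndex n (+ i) ≡ + j
reflectIndex-position n i j eq = begin
  + suc n - + i        ≡⟨ cong (λ m → + m - + i) eq ⟩
  + (i ℕ.+ j) - + i    ≡⟨ cong (_- + i) (ℤP.pos-+ i j) ⟩
  (+ i ℤ.+ + j) - + i  ≡⟨ cancel (+ i) (+ j) ⟩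
  + j                  ∎
  where
  open ≡-Reasoning
  cancel : ∀ a b → (a ℤ.+ b) - a ≡ b
  cancel = solve-∀

∈-peakHere : ∀ {i} j a b c rest →
  i ∈ peakHere j a b c rest ⇔ ((i ≡ j × a ℤ.< b × c ℤ.< b) ⊎ i ∈ rest)
∈-peakHere {i} j a b c rest = mk⇔ to from
  where
  to : i ∈ peakHere j a b c rest → (i ≡ j × a ℤ.< b × c ℤ.< b) ⊎ i ∈ rest
  to i∈ with a ℤ.<? b | c ℤ.<? b
  to (here refl) | yes a<b | yes c<b = inj₁ (refl , a<b , c<b)
  to (there i∈)  | yes _   | yes _   = inj₂ i∈
  ... | yes _ | no _ = inj₂ i∈
  ... | no _  | _    = inj₂ i∈
  from : (i ≡ j × a ℤ.< b × c ℤ.< b) ⊎ i ∈ rest → i ∈ peakHere j a b c rest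
  from p with a ℤ.<? b | c ℤ.<? b | p
  ... | yes _   | yes _   | inj₁ (refl , _) = here refl
  ... | yes _   | yes _   | inj₂ i∈         = there i∈
  ... | yes _   | no c≮b  | inj₁ (_ , _ , c<b) = ⊥-elim (c≮b c<b)
  ... | yes _   | no _    | inj₂ i∈         = i∈
  ... | no a≮b  | _       | inj₁ (_ , a<b , _) = ⊥-elim (a≮b a<b)
  ... | no _    | _       | inj₂ i∈         = i∈

PeakAt : ℕ → List ℤ → ℕ → Set
PeakAt k w i = ∃ λ xs → ∃ λ a → ∃ λ b → ∃ λ c → ∃ λ ys →
  w ≡ xs ++ a ∷ b ∷ c ∷ ys × i ≡ suc (k ℕ.+ length xs) × a ℤ.< b × c ℤ.< b

peaksFrom-complete : ∀ k xs a b c ys → a ℤ.< b → c ℤ.< b →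
  suc (k ℕ.+ length xs) ∈ peaksFrom k (xs ++ a ∷ b ∷ c ∷ ys)
peaksFrom-complete k [] a b c ys a<b c<b rewrite ℕP.+-identityʳ k =
  Equivalence.from (∈-peakHere (suc k) a b c _) (inj₁ (refl , a<b , c<b))
peaksFrom-complete k (x ∷ xs) a b c ys a<b c<b with xs ++ a ∷ b ∷ c ∷ ys
  | peaksFrom-complete (suc k) xs a b c ys a<b c<b
... | y ∷ z ∷ r | later rewrite ℕP.+-suc k (length xs) =
  Equivalence.from (∈-peakHere (suc k) x y z _) (inj₂ later)

peakAt-cons : ∀ k a b c r {i} →
  (i ∈ peaksFrom (suc k) (b ∷ c ∷ r) → PeakAt (suc k) (b ∷ c ∷ r) i) →
  i ∈ peaksFrom k (a ∷ b ∷ c ∷ r) → PeakAt k (a ∷ b ∷ c ∷ r) i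
peakAt-cons k a b c r later-sound i∈
  with Equivalence.to (∈-peakHere (suc k) a b c (peaksFrom (suc k) (b ∷ c ∷ r))) i∈
... | inj₁ (refl , a<b , c<b) =
  [] , a , b , c , r , refl , cong suc (sym (ℕP.+-identityʳ k)) , a<b , c<b
... | inj₂ later with later-sound later
... | xs , a' , b' , c' , ys , eq , refl , a'<b' , c'<b' =
  a ∷ xs , a' , b' , c' , ys , cong (a ∷_) eq ,
  cong suc (sym (ℕP.+-suc k (length xs))) , a'<b' , c'<b'

peaksFrom-sound : ∀ k w {i} → i ∈ peaksFrom k w → PeakAt k w i
peaksFrom-sound k (a ∷ b ∷ c ∷ r) = peakAt-cons k a b c r (peaksFrom-sound (suc k) (b ∷ c ∷ r))

reverse-split : ∀ (xs : List ℤ) a b c ys →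
  reverse (xs ++ a ∷ b ∷ c ∷ ys) ≡ reverse ys ++ c ∷ b ∷ a ∷ reverse xs
reverse-split xs a b c ys = begin
  reverse (xs ++ (a ∷ b ∷ c ∷ []) ++ ys)         ≡⟨ reverse-++ xs _ ⟩
  reverse ((a ∷ b ∷ c ∷ []) ++ ys) ++ reverse xs ≡⟨ cong (_++ reverse xs) (reverse-++ (a ∷ b ∷ c ∷ []) ys) ⟩
  (reverse ys ++ c ∷ b ∷ a ∷ []) ++ reverse xs   ≡⟨ ++-assoc (reverse ys) _ _ ⟩
  reverse ys ++ c ∷ b ∷ a ∷ reverse xs           ∎
  where open ≡-Reasoning

peak-reverse : ∀ n π {i} → length π ≡ n → i ∈ peakSet π →
  reflectIndex n i ∈ peakSet (reverse π)
peak-reverse n π len p with ∈-map⁻ +_ p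
... | i , i∈ , refl with peaksFrom-sound 1 π i∈
... | xs , a , b , c , ys , refl , refl , a<b , c<b =
  subst (_∈ peakSet (reverse (xs ++ a ∷ b ∷ c ∷ ys))) (sym reflected)
    (∈-map⁺ +_ (subst (λ w → 2 ℕ.+ length (reverse ys) ∈ peaksFrom 1 w)
      (sym (reverse-split xs a b c ys))
      (peaksFrom-complete 1 (reverse ys) c b a (reverse xs) c<b a<b)))
  where
  open ≡-Reasoning
  total : suc n ≡ (2 ℕ.+ length xs) ℕ.+ (2 ℕ.+ length (reverse ys))
  total = begin
    suc n                                     ≡⟨ cong suc (sym len) ⟩
    suc (length (xs ++ a ∷ b ∷ c ∷ ys))       ≡⟨ cong suc (length-++ xs) ⟩
    suc (length xs ℕ.+ (3 ℕ.+ length ys))     ≡⟨ cong suc (ℕP.+-suc (length xs) _) ⟩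
    (2 ℕ.+ length xs) ℕ.+ (2 ℕ.+ length ys)   ≡⟨ cong (λ m → (2 ℕ.+ length xs) ℕ.+ (2 ℕ.+ m)) (sym (length-reverse ys)) ⟩
    (2 ℕ.+ length xs) ℕ.+ (2 ℕ.+ length (reverse ys)) ∎
  reflected : reflectIndex n (+ (2 ℕ.+ length xs)) ≡ + (2 ℕ.+ length (reverse ys))
  reflected = reflectIndex-position n (2 ℕ.+ length xs) (2 ℕ.+ length (reverse ys)) total

peakSet-reverse-swaps : ∀ n π → length π ≡ n →
  Swaps (reflectIndex n) (peakSet (reverse π)) (peakSet π)
peakSet-reverse-swaps n π len =
  (λ p → subst (λ w → _ ∈ peakSet w) (reverse-involutive π)
           (peak-reverse n (reverse π) (trans (length-reverse π) len) p)) ,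
  peak-reverse n π len

peakSet-reverse : ∀ n π S → length π ≡ n →
  peakSet π ≈ₛ S ⇔ peakSet (reverse π) ≈ₛ reflectSet n S
peakSet-reverse n π S len =
  ≈ₛ-transport⇔ (reflectIndex-involution n)
    (swaps-sym (peakSet-reverse-swaps n π len))
    (swaps-sym (swaps-map (reflectIndex-involution n) S))

∈-words : ∀ {A : Set} n (xs : List A) {π} → π ∈ words n xs ⇔ (length π ≡ n × All (_∈ xs) π)
∈-words n xs = mk⇔ (to n) (from n)
  where
  to : ∀ n {π} → π ∈ words n xs → length π ≡ n × All (_∈ xs) π
  to zero (here refl) = refl , []
  to (suc n) π∈ with ∈-cartesianProductWith⁻ _∷_ xs (words n xs) π∈
  ... | a , w , a∈ , w∈ , refl with to n w∈
  ... | len , all = cong suc len , a∈ ∷ all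
  from : ∀ n {π} → length π ≡ n × All (_∈ xs) π → π ∈ words n xs
  from zero {[]} (refl , []) = here refl
  from (suc n) {a ∷ π} (refl , a∈ ∷ all) = ∈-cartesianProductWith⁺ _∷_ a∈ (from n (refl , all))

words-unique : ∀ {A : Set} n (xs : List A) → Unique xs → Unique (words n xs)
words-unique zero    xs u = [] AllPairs.∷ AllPairs.[]
words-unique (suc n) xs u = Unique.cartesianProductWith⁺ _∷_ ∷-injective u (words-unique n xs u)
  where
  ∷-injective : ∀ {a a' : _} {w w' : List _} → a ∷ w ≡ a' ∷ w' → a ≡ a' × w ≡ w'
  ∷-injective refl = refl , refl

letters-unique : ∀ n → Unique (letters n)
letters-unique n =
  Unique.++⁺ (Unique.map⁺ neg-injective (Unique.upTo⁺ n))
             (Unique.map⁺ pos-injective (Unique.upTo⁺ n)) disjoint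
  where
  neg-injective : ∀ {x y} → -[1+ x ] ≡ -[1+ y ] → x ≡ y
  neg-injective refl = refl
  pos-injective : ∀ {x y} → + suc x ≡ + suc y → x ≡ y
  pos-injective refl = refl
  disjoint : ∀ {v} → ¬ (v ∈ map (λ k → -[1+ k ]) (upTo n) × v ∈ map (λ k → + suc k) (upTo n))
  disjoint (v∈neg , v∈pos) with ∈-map⁻ (λ k → -[1+ k ]) v∈neg | ∈-map⁻ (λ k → + suc k) v∈pos
  ... | _ , _ , refl | _ , _ , ()

Bn-unique : ∀ n → Unique (Bn n)
Bn-unique n = Unique.filter⁺ (λ π → unique? (map ∣_∣ π)) (words-unique n (letters n) (letters-unique n))

Bn-length : ∀ n {π} → π ∈ Bn n → length π ≡ n
Bn-length n π∈ = proj₁ (Equivalence.to (∈-words n (letters n))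
  (proj₁ (∈-filter⁻ (λ π → unique? (map ∣_∣ π)) π∈)))

Bn-reverse : ∀ n {π} → π ∈ Bn n → reverse π ∈ Bn n
Bn-reverse n {π} π∈ with ∈-filter⁻ (λ π → unique? (map ∣_∣ π)) π∈
... | π∈words , distinct with Equivalence.to (∈-words n (letters n)) π∈words
... | len , all = ∈-filter⁺ (λ π → unique? (map ∣_∣ π))
  (Equivalence.from (∈-words n (letters n))
    (trans (length-reverse π) len , All-resp-↭ (↭-sym (↭-reverse π)) all))
  (subst Unique (sym (reverse-map ∣_∣ π))
    (PermutationSetoid.Unique-resp-↭ (setoid ℕ)
      (↭⇒↭ₛ (↭-sym (↭-reverse (map ∣_∣ π)))) distinct))

-- Reversal is an involution of B_n carrying P_B(S,n) onto P_B(T,n).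
proposition2p2 : (n : ℕ) → 1 ≤ n → (S : List ℤ) →
    #PB S n ≡ #PB (reflectSet n S) n
proposition2p2 n _ S =
  count-invariant (λ π → peakSet π ≈ₛ? S) (λ π → peakSet π ≈ₛ? reflectSet n S)
    reverse reverse-involutive (Bn-unique n) (Bn-reverse n)
    (λ {π} π∈ → peakSet-reverse n π S (Bn-length n π∈))
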